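{- Let $w$ be a word with $s_1(w)=s_2(w)=2$ (a 2FS square), and let $sq_1,SQ_1$ (resp. $sq_2,SQ_2$) be the roots of the two squares whose last occurrence in $w$ starts at location 1 (resp. 2), with $|sq_1|<|SQ_1|$ and $|sq_2|<|SQ_2|$. If $|SQ_1|=|SQ_2|$, then $|sq_1|=|sq_2|$.
   Context: A square is a word $uu$ with $u$ nonempty; $u$ is its root. A square $uu$ occurs at location $k$ of $w=a_1\cdots a_n$ if $a_k\cdots a_{k+2|u|-1}=uu$. $s_k(w)$ is the number of distinct squares occurring at location $k$ of $w$ but at no location $k'>k$. It is known that $s_k(w)\le 2$. -}

module Defs where

open import Data.List using (List; []; _∷_; _++_; drop; length)
open import Data.List.Relation.Binary.Prefix.Heterogeneous using (Prefix)
open import Data.Nat using (ℕ; _<_)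
open import Data.Product using (_×_)
open import Data.Sum using (_⊎_)
open import Relation.Binary.PropositionalEquality using (_≡_)
open import Relation.Nullary using (¬_)

-- Words over an alphabet A are lists. Locations are 0-indexed here:
-- paper location k corresponds to index k - 1.

IsPrefix : {A : Set} → List A → List A → Set
IsPrefix xs ys = Prefix _≡_ xs ys

OccursAt : {A : Set} → List A → ℕ → List A → Set
OccursAt w i u = ¬ (u ≡ []) × IsPrefix (u ++ u) (drop i w)

LastOccAt : {A : Set} → List A → ℕ → List A → Set
LastOccAt w i u = OccursAt w i u × (∀ j → i < j → ¬ OccursAt w j u)

-- s_i(w) = 2, with the two squares having roots sq and SQ, |sq| < |SQ|:
-- both are last-occurrence roots at i, and every such root is one of them.
-- (Since |sq| < |SQ| they are distinct, so exactly two squares.)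
TwoLastAt : {A : Set} → List A → ℕ → List A → List A → Set
TwoLastAt w i sq SQ =
  LastOccAt w i sq × LastOccAt w i SQ × length sq < length SQ ×
  (∀ u → LastOccAt w i u → (u ≡ sq) ⊎ (u ≡ SQ))

{-# OPTIONS --safe #-}
-- The two squares of root length L, at positions 0 and 1, make w[0 .. 2L] a prefix of an
-- L-periodic word G. A square of root a at position i ≤ 1 that does not recur must have
-- L ≤ 2a (otherwise it recurs L positions later), and it makes L − a a period of G on the
-- window [i + a, i + a + L). If a < b are the roots of two such squares, their windows
-- overlap in at least (L − a) + (L − b) − 1 positions, so by Fine and Wilf g = gcd(L − a, L − b)
-- is a period of both windows, hence of their union, which is at least L + g − 1 long; a
-- second application of Fine and Wilf makes h = gcd(g, L) a period of all of G. Since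
-- h ≤ L − b, the square of root b then recurs h positions later, a contradiction.
module Submission where

open import Data.Empty using (⊥-elim)
open import Data.List using (List; []; _∷_; _++_; drop; length)
open import Data.List.Properties using (length-++)
open import Data.List.Relation.Binary.Prefix.Heterogeneous using (Prefix; []; _∷_)
open import Data.Maybe using (Maybe; just; nothing)
open import Data.Maybe.Properties using (just-injective)
open import Data.Nat
open import Data.Nat.DivMod
open import Data.Nat.Divisibility
open import Data.Nat.GCD using (gcd; gcd[m,n]≢0; GCD; module GCD; gcd-GCD)
open import Data.Nat.Properties
open import Algebra.Properties.CommutativeSemigroup +-commutativeSemigroup using () renaming (xy∙z≈xz∙y to +-rightComm)
open import Data.Product using (∃-syntax; _×_; _,_)
open import Data.Sum using (inj₁; inj₂)
open import Relation.Binary using (Tri; tri<; tri≈; tri>)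
open import Relation.Binary.PropositionalEquality
open import Relation.Nullary using (¬_; yes; no)

open import Defs

n≡m+[n/d∸m/d]*d : ∀ {m n} d .{{_ : NonZero d}} → m ≤ n → m % d ≡ n % d → n ≡ m + (n / d ∸ m / d) * d
n≡m+[n/d∸m/d]*d {m} {n} d m≤n m%d≡n%d = begin
  n                             ≡⟨ m≡m%n+[m/n]*n n d ⟩
  n % d + n / d * d             ≡⟨ cong₂ _+_ (sym m%d≡n%d) (cong (_* d) (sym (m+[n∸m]≡n (/-monoˡ-≤ d m≤n)))) ⟩
  m % d + (m / d + k) * d       ≡⟨ cong (m % d +_) (*-distribʳ-+ d (m / d) k) ⟩
  m % d + (m / d * d + k * d)   ≡⟨ +-assoc (m % d) _ _ ⟨
  m % d + m / d * d + k * d     ≡⟨ cong (_+ k * d) (m≡m%n+[m/n]*n m d) ⟨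
  m + k * d                     ∎
  where
    open ≡-Reasoning
    k = n / d ∸ m / d

[m+n%d]%d≡[m+n]%d : ∀ m n d .{{_ : NonZero d}} → (m + n % d) % d ≡ (m + n) % d
[m+n%d]%d≡[m+n]%d m n d = begin
  (m + n % d) % d           ≡⟨ %-distribˡ-+ m (n % d) d ⟩
  (m % d + n % d % d) % d   ≡⟨ cong (λ r → (m % d + r) % d) (m%n%n≡m%n n d) ⟩
  (m % d + n % d) % d       ≡⟨ %-distribˡ-+ m n d ⟨
  (m + n) % d               ∎
  where open ≡-Reasoning

%-representative : ∀ d lo x .{{_ : NonZero d}} → ∃[ y ] lo ≤ y × y < lo + d × y % d ≡ x % d
-- lo * d ≥ lo is a multiple of d, so shifting x by it keeps the residue and makes room for lo.
%-representative d lo x = lo + s % d , m≤m+n lo _ , +-monoʳ-< lo (m%n<n s d) , y%d≡x%d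
  where
    s = x + (lo * d ∸ lo)
    lo+s≡x+lo*d : lo + s ≡ x + lo * d
    lo+s≡x+lo*d = begin
      lo + (x + (lo * d ∸ lo))   ≡⟨ +-assoc lo x _ ⟨
      lo + x + (lo * d ∸ lo)     ≡⟨ cong (_+ (lo * d ∸ lo)) (+-comm lo x) ⟩
      x + lo + (lo * d ∸ lo)     ≡⟨ +-assoc x lo _ ⟩
      x + (lo + (lo * d ∸ lo))   ≡⟨ cong (x +_) (m+[n∸m]≡n (m≤m*n lo d)) ⟩
      x + lo * d                 ∎
      where open ≡-Reasoning
    y%d≡x%d : (lo + s % d) % d ≡ x % d
    y%d≡x%d = begin
      (lo + s % d) % d   ≡⟨ [m+n%d]%d≡[m+n]%d lo s d ⟩
      (lo + s) % d       ≡⟨ cong (_% d) lo+s≡x+lo*d ⟩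
      (x + lo * d) % d   ≡⟨ [m+kn]%n≡m%n x lo d ⟩
      x % d              ∎
      where open ≡-Reasoning

%-≡-coarsen : ∀ {g d x y} .{{_ : NonZero g}} .{{_ : NonZero d}} → g ∣ d → x % d ≡ y % d → x % g ≡ y % g
%-≡-coarsen {g} {d} {x} {y} g∣d x≡y = begin
  x % g       ≡⟨ m∣n⇒o%n%m≡o%m g d x g∣d ⟨
  x % d % g   ≡⟨ cong (_% g) x≡y ⟩
  y % d % g   ≡⟨ m∣n⇒o%n%m≡o%m g d y g∣d ⟩
  y % g       ∎
  where open ≡-Reasoning

gcd-nonZero : ∀ m n .{{_ : NonZero m}} → NonZero (gcd m n)
gcd-nonZero m n = ≢-nonZero (gcd[m,n]≢0 m n (inj₁ (≢-nonZero⁻¹ m)))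

GCD-∸ : ∀ {m n d} → n ≤ m → GCD m n d → GCD (m ∸ n) n d
GCD-∸ {m} {n} {d} n≤m (GCD.is (d∣m , d∣n) greatest) =
  GCD.is (∣m+n∣m⇒∣n (subst (d ∣_) (sym (m+[n∸m]≡n n≤m)) d∣m) d∣n , d∣n)
         (λ (e∣m∸n , e∣n) → greatest (∣m∸n∣n⇒∣m _ n≤m e∣m∸n e∣n , e∣n))

GCD⇒≤∸ : ∀ {m n d} → n < m → GCD m n d → d ≤ m ∸ n
GCD⇒≤∸ n<m g = ∣⇒≤ {{>-nonZero (m<n⇒0<n∸m n<m)}} (GCD.gcd∣m (GCD-∸ (<⇒≤ n<m) g))

m<n∸o⇒m+o<n : ∀ {m n o} → m < n ∸ o → m + o < n
m<n∸o⇒m+o<n {m} {n} {o} m<n∸o = m≤o∸n⇒m+n≤o (suc m) o≤n m<n∸o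
  where
    o≤n : o ≤ n
    o≤n = <⇒≤ (m∸n≢0⇒n<m (λ n∸o≡0 → n≮0 (subst (m <_) n∸o≡0 m<n∸o)))

SquareAt : {B : Set} → (ℕ → B) → ℕ → ℕ → Set
SquareAt f i a = ∀ k → k < a → f (i + k) ≡ f (i + a + k)

Reappears : {B : Set} → (ℕ → B) → ℕ → ℕ → ℕ → Set
Reappears f i n j = ∀ k → k < n → f (j + k) ≡ f (i + k)

module Periodicity {B : Set} (G : ℕ → B) where

  Period : ℕ → ℕ → ℕ → Set
  Period p lo hi = ∀ x → lo ≤ x → x + p < hi → G x ≡ G (x + p)

  ConstMod : (g : ℕ) .{{_ : NonZero g}} → ℕ → ℕ → Set
  ConstMod g lo hi = ∀ x y → lo ≤ x → x < hi → lo ≤ y → y < hi → x % g ≡ y % g → G x ≡ G y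

  Period-restrict : ∀ {p lo hi lo′ hi′} → lo ≤ lo′ → hi′ ≤ hi → Period p lo hi → Period p lo′ hi′
  Period-restrict lo≤lo′ hi′≤hi P x lo′≤x x+p<hi′ = P x (≤-trans lo≤lo′ lo′≤x) (<-≤-trans x+p<hi′ hi′≤hi)

  Period-* : ∀ {p lo hi} → Period p lo hi → ∀ k → Period (k * p) lo hi
  Period-* P zero x _ _ = cong G (sym (+-identityʳ x))
  Period-* {p} {lo} {hi} P (suc k) x lo≤x x+[p+kp]<hi = begin
    G x                  ≡⟨ P x lo≤x (≤-<-trans (+-monoʳ-≤ x (m≤m+n p (k * p))) x+[p+kp]<hi) ⟩
    G (x + p)            ≡⟨ Period-* P k (x + p) (≤-trans lo≤x (m≤m+n x p)) x+p+kp<hi ⟩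
    G (x + p + k * p)    ≡⟨ cong G (+-assoc x p (k * p)) ⟩
    G (x + (p + k * p))  ∎
    where
      open ≡-Reasoning
      x+p+kp<hi = subst (_< hi) (sym (+-assoc x p (k * p))) x+[p+kp]<hi

  Period⇒≡-mod : ∀ {p lo hi} .{{_ : NonZero p}} → Period p lo hi →
                 ∀ {x y} → lo ≤ x → y < hi → x ≤ y → x % p ≡ y % p → G x ≡ G y
  Period⇒≡-mod {p} {hi = hi} P {x} {y} lo≤x y<hi x≤y x≡y =
    trans (Period-* P (y / p ∸ x / p) x lo≤x (subst (_< hi) y≡x+kp y<hi)) (cong G (sym y≡x+kp))
    where y≡x+kp = n≡m+[n/d∸m/d]*d p x≤y x≡y

  Period⇒ConstMod : ∀ {p lo hi} .{{_ : NonZero p}} → Period p lo hi → ConstMod p lo hi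
  Period⇒ConstMod P x y lo≤x x<hi lo≤y y<hi x≡y with ≤-total x y
  ... | inj₁ x≤y = Period⇒≡-mod P lo≤x y<hi x≤y x≡y
  ... | inj₂ y≤x = sym (Period⇒≡-mod P lo≤y x<hi y≤x (sym x≡y))

  ConstMod⇒Period : ∀ {g lo hi} .{{_ : NonZero g}} → ConstMod g lo hi → Period g lo hi
  ConstMod⇒Period {g} M x lo≤x x+g<hi =
    M x (x + g) lo≤x (≤-<-trans (m≤m+n x g) x+g<hi) (≤-trans lo≤x (m≤m+n x g)) x+g<hi (sym ([m+n]%n≡m%n x g))

  ConstMod-cong : ∀ {g h lo hi} .{{_ : NonZero g}} .{{_ : NonZero h}} → g ≡ h → ConstMod g lo hi → ConstMod h lo hi
  ConstMod-cong refl M = M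

  ConstMod-extend : ∀ {g p lo hi l h} .{{_ : NonZero g}} .{{_ : NonZero p}} → g ∣ p → Period p lo hi →
                    lo ≤ l → l + p ≤ h → h ≤ hi → ConstMod g l h → ConstMod g lo hi
  ConstMod-extend {g} {p} {lo} {hi} {l} {h} g∣p P lo≤l l+p≤h h≤hi M x y lo≤x x<hi lo≤y y<hi x≡y =
    let x′ , l≤x′ , x′<l+p , x′≡x = %-representative p l x
        y′ , l≤y′ , y′<l+p , y′≡y = %-representative p l y
        x′<h = <-≤-trans x′<l+p l+p≤h
        y′<h = <-≤-trans y′<l+p l+p≤h
    in begin
      G x   ≡⟨ Period⇒ConstMod P x x′ lo≤x x<hi (≤-trans lo≤l l≤x′) (<-≤-trans x′<h h≤hi) (sym x′≡x) ⟩
      G x′  ≡⟨ M x′ y′ l≤x′ x′<h l≤y′ y′<h (trans (%-≡-coarsen g∣p x′≡x) (trans x≡y (sym (%-≡-coarsen g∣p y′≡y)))) ⟩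
      G y′  ≡⟨ Period⇒ConstMod P y′ y (≤-trans lo≤l l≤y′) (<-≤-trans y′<h h≤hi) lo≤y y<hi y′≡y ⟩
      G y   ∎
    where open ≡-Reasoning

  ConstMod-union : ∀ {g l₁ h₁ l₂ h₂} .{{_ : NonZero g}} → l₁ ≤ l₂ → l₂ + g ≤ h₁ → h₁ ≤ h₂ →
                   ConstMod g l₁ h₁ → ConstMod g l₂ h₂ → ConstMod g l₁ h₂
  ConstMod-union {g} {l₁} {h₁} {l₂} {h₂} l₁≤l₂ l₂+g≤h₁ h₁≤h₂ M₁ M₂ = union
    where
      beyond : ∀ {z} → z ≮ h₁ → l₂ ≤ z
      beyond z≮h₁ = ≤-trans (≤-trans (m≤m+n l₂ g) l₂+g≤h₁) (≮⇒≥ z≮h₁)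

      bridge : ∀ {x y} → l₁ ≤ x → x < h₁ → l₂ ≤ y → y < h₂ → x % g ≡ y % g → G x ≡ G y
      bridge {x} {y} l₁≤x x<h₁ l₂≤y y<h₂ x≡y =
        let z , l₂≤z , z<l₂+g , z≡x = %-representative g l₂ x
            z<h₁ = <-≤-trans z<l₂+g l₂+g≤h₁
        in trans (M₁ x z l₁≤x x<h₁ (≤-trans l₁≤l₂ l₂≤z) z<h₁ (sym z≡x))
                 (M₂ z y l₂≤z (<-≤-trans z<h₁ h₁≤h₂) l₂≤y y<h₂ (trans z≡x x≡y))

      union : ConstMod g l₁ h₂
      union x y l₁≤x x<h₂ l₁≤y y<h₂ x≡y with x <? h₁ | y <? h₁
      ... | yes x<h₁ | yes y<h₁ = M₁ x y l₁≤x x<h₁ l₁≤y y<h₁ x≡y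
      ... | yes x<h₁ | no y≮h₁  = bridge l₁≤x x<h₁ (beyond y≮h₁) y<h₂ x≡y
      ... | no x≮h₁  | yes y<h₁ = sym (bridge l₁≤y y<h₁ (beyond x≮h₁) x<h₂ (sym x≡y))
      ... | no x≮h₁  | no y≮h₁  = M₂ x y (beyond x≮h₁) x<h₂ (beyond y≮h₁) y<h₂ x≡y

  Period-∸ : ∀ {p q lo hi} → q ≤ p → Period p lo hi → Period q lo hi → Period (p ∸ q) lo (hi ∸ q)
  Period-∸ {p} {q} {lo} {hi} q≤p P Q x lo≤x x+[p∸q]<hi∸q = begin
    G x                  ≡⟨ P x lo≤x (subst (_< hi) x+[p∸q]+q≡x+p x+[p∸q]+q<hi) ⟩
    G (x + p)            ≡⟨ cong G x+[p∸q]+q≡x+p ⟨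
    G (x + (p ∸ q) + q)  ≡⟨ Q (x + (p ∸ q)) (≤-trans lo≤x (m≤m+n x (p ∸ q))) x+[p∸q]+q<hi ⟨
    G (x + (p ∸ q))      ∎
    where
      open ≡-Reasoning
      x+[p∸q]+q<hi = m<n∸o⇒m+o<n x+[p∸q]<hi∸q
      x+[p∸q]+q≡x+p = trans (+-assoc x (p ∸ q) q) (cong (x +_) (m∸n+n≡m q≤p))

  -- Fine and Wilf's theorem (for intervals of length p + q − 1), by Euclid's algorithm on the
  -- two periods; the fuel n ≥ p + q makes the recursion structural.
  fine-wilf-fuel : ∀ n {p q g lo hi} .{{_ : NonZero p}} .{{_ : NonZero q}} .{{_ : NonZero g}} → GCD p q g →
                   p + q ≤ n → Period p lo hi → Period q lo hi → lo + p + q ≤ suc hi → ConstMod g lo hi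
  fine-wilf-step : ∀ n {p q g lo hi} .{{_ : NonZero p}} .{{_ : NonZero q}} .{{_ : NonZero g}} → GCD p q g →
                   q < p → p + q ≤ suc n → Period p lo hi → Period q lo hi → lo + p + q ≤ suc hi → ConstMod g lo hi

  fine-wilf-fuel zero {p} _ p+q≤0 = ⊥-elim (n≮0 (<-≤-trans (>-nonZero⁻¹ p) (m+n≤o⇒m≤o p p+q≤0)))
  fine-wilf-fuel (suc n) {p} {q} {g} {lo} {hi} gcd p+q≤n P Q bound = by-cases (<-cmp p q)
    where
      by-cases : Tri (p < q) (p ≡ q) (q < p) → ConstMod g lo hi
      by-cases (tri≈ _ p≡q _) =
        ConstMod-cong (GCD.unique GCD.refl (subst (λ r → GCD p r g) (sym p≡q) gcd)) (Period⇒ConstMod P)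
      by-cases (tri> _ _ q<p) = fine-wilf-step n gcd q<p p+q≤n P Q bound
      by-cases (tri< p<q _ _) = fine-wilf-step n (GCD.sym gcd) p<q (subst (_≤ suc n) (+-comm p q) p+q≤n) Q P
                                  (subst (_≤ suc hi) (+-rightComm lo p q) bound)

  fine-wilf-step n {p} {q} {g} {lo} {hi} gcd q<p p+q≤1+n P Q bound =
    ConstMod-extend (GCD.gcd∣n gcd) Q ≤-refl lo+q≤hi∸q (m∸n≤m hi q)
      (fine-wilf-fuel n (GCD-∸ q≤p gcd) [p∸q]+q≤n (Period-∸ q≤p P Q) (Period-restrict ≤-refl (m∸n≤m hi q) Q) bound′)
    where
      q≤p = <⇒≤ q<p
      instance
        p∸q-nonZero : NonZero (p ∸ q)
        p∸q-nonZero = >-nonZero (m<n⇒0<n∸m q<p)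
      lo+q+q≤hi : lo + q + q ≤ hi
      lo+q+q≤hi = ≤-pred (<-≤-trans (+-monoˡ-< q (+-monoʳ-< lo q<p)) bound)
      q≤hi : q ≤ hi
      q≤hi = ≤-trans (m≤n+m q (lo + q)) lo+q+q≤hi
      lo+q≤hi∸q : lo + q ≤ hi ∸ q
      lo+q≤hi∸q = m+n≤o⇒m≤o∸n (lo + q) lo+q+q≤hi
      [p∸q]+q≤n : p ∸ q + q ≤ n
      [p∸q]+q≤n = subst (_≤ n) (sym (m∸n+n≡m q≤p)) (≤-pred (<-≤-trans (m<m+n p (>-nonZero⁻¹ q)) p+q≤1+n))
      bound′ : lo + (p ∸ q) + q ≤ suc (hi ∸ q)
      bound′ = begin
        lo + (p ∸ q) + q   ≡⟨ +-assoc lo (p ∸ q) q ⟩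
        lo + (p ∸ q + q)   ≡⟨ cong (lo +_) (m∸n+n≡m q≤p) ⟩
        lo + p             ≤⟨ m+n≤o⇒m≤o∸n (lo + p) bound ⟩
        suc hi ∸ q         ≡⟨ +-∸-assoc 1 q≤hi ⟩
        suc (hi ∸ q)       ∎
        where open ≤-Reasoning

  fine-wilf : ∀ {p q g lo hi} .{{_ : NonZero p}} .{{_ : NonZero q}} .{{_ : NonZero g}} → GCD p q g →
              Period p lo hi → Period q lo hi → lo + p + q ≤ suc hi → ConstMod g lo hi
  fine-wilf {p} {q} gcd = fine-wilf-fuel (p + q) gcd ≤-refl

  ConstMod-overlapping-windows : ∀ {p q g x y L} .{{_ : NonZero p}} .{{_ : NonZero q}} .{{_ : NonZero g}} →
    GCD p q g → x ≤ y → y + p + q ≤ suc (x + L) → Period p x (x + L) → Period q y (y + L) → ConstMod g x (y + L)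
  ConstMod-overlapping-windows {p} {q} {g} {x} {y} {L} gcd x≤y bound P Q =
    ConstMod-union x≤y y+g≤x+L x+L≤y+L
      (ConstMod-extend (GCD.gcd∣m gcd) P x≤y y+p≤x+L ≤-refl on-overlap)
      (ConstMod-extend (GCD.gcd∣n gcd) Q ≤-refl y+q≤x+L x+L≤y+L on-overlap)
    where
      x+L≤y+L = +-monoˡ-≤ L x≤y
      on-overlap : ConstMod g y (x + L)
      on-overlap = fine-wilf gcd (Period-restrict x≤y ≤-refl P) (Period-restrict ≤-refl x+L≤y+L Q) bound
      y+p≤x+L : y + p ≤ x + L
      y+p≤x+L = ≤-pred (<-≤-trans (m<m+n (y + p) (>-nonZero⁻¹ q)) bound)
      y+q≤x+L : y + q ≤ x + L
      y+q≤x+L = ≤-pred (<-≤-trans (+-monoˡ-< q (m<m+n y (>-nonZero⁻¹ p))) bound)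
      y+g≤x+L : y + g ≤ x + L
      y+g≤x+L = ≤-trans (+-monoʳ-≤ y (∣⇒≤ (GCD.gcd∣m gcd))) y+p≤x+L

  module Periodic (L : ℕ) .{{_ : NonZero L}} (G-periodic : ∀ x → G (x + L) ≡ G x) where

    Period-L : ∀ lo hi → Period L lo hi
    Period-L lo hi x _ _ = sym (G-periodic x)

    G-≡-mod : ∀ x y → x % L ≡ y % L → G x ≡ G y
    G-≡-mod x y = Period⇒ConstMod (Period-L 0 (suc (x + y))) x y z≤n (s≤s (m≤m+n x y)) z≤n (s≤s (m≤n+m y x))

    ConstMod⇒periodic : ∀ {h lo hi} .{{_ : NonZero h}} → h ∣ L → lo + L ≤ hi → ConstMod h lo hi →
                        ∀ x → G (x + h) ≡ G x
    ConstMod⇒periodic {h} {lo} {hi} h∣L lo+L≤hi M x =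
      let x′ , lo≤x′ , x′<lo+L , x′≡x = %-representative L lo x
          z′ , lo≤z′ , z′<lo+L , z′≡x+h = %-representative L lo (x + h)
          x′≡z′ = trans (%-≡-coarsen h∣L x′≡x) (trans (sym ([m+n]%n≡m%n x h)) (sym (%-≡-coarsen h∣L z′≡x+h)))
      in begin
        G (x + h)  ≡⟨ G-≡-mod (x + h) z′ (sym z′≡x+h) ⟩
        G z′       ≡⟨ M x′ z′ lo≤x′ (<-≤-trans x′<lo+L lo+L≤hi) lo≤z′ (<-≤-trans z′<lo+L lo+L≤hi) x′≡z′ ⟨
        G x′       ≡⟨ G-≡-mod x′ x x′≡x ⟩
        G x        ∎
      where open ≡-Reasoning

    periodic-of-window : ∀ {g h lo hi} .{{_ : NonZero g}} .{{_ : NonZero h}} → GCD g L h →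
                         lo + g + L ≤ suc hi → Period g lo hi → ∀ x → G (x + h) ≡ G x
    periodic-of-window {g} {h} {lo} {hi} gcd bound P =
      ConstMod⇒periodic (GCD.gcd∣n gcd) lo+L≤hi (fine-wilf gcd P (Period-L lo hi) bound)
      where
        lo+L≤hi : lo + L ≤ hi
        lo+L≤hi = ≤-pred (<-≤-trans (+-monoˡ-< L (m<m+n lo (>-nonZero⁻¹ g))) bound)

    Period-of-square : ∀ {i a p} → a + p ≡ L → SquareAt G i a → Period p (i + a) (i + a + L)
    Period-of-square {i} {a} {p} a+p≡L sq x i+a≤x x+p<i+a+L =
      subst (λ z → G z ≡ G (z + p)) (m+[n∸m]≡n i+a≤x) (shifted (x ∸ (i + a)) k<a)
      where
        shifted : ∀ k → k < a → G (i + a + k) ≡ G (i + a + k + p)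
        shifted k k<a = begin
          G (i + a + k)      ≡⟨ sq k k<a ⟨
          G (i + k)          ≡⟨ G-periodic (i + k) ⟨
          G (i + k + L)      ≡⟨ cong (λ z → G (i + k + z)) a+p≡L ⟨
          G (i + k + (a + p))  ≡⟨ cong G (+-assoc (i + k) a p) ⟨
          G (i + k + a + p)  ≡⟨ cong (λ z → G (z + p)) (+-rightComm i k a) ⟩
          G (i + a + k + p)  ∎
          where open ≡-Reasoning
        x<i+a+a : x < i + a + a
        x<i+a+a = +-cancelʳ-< p x (i + a + a)
          (subst (x + p <_) (trans (cong (i + a +_) (sym a+p≡L)) (sym (+-assoc (i + a) a p))) x+p<i+a+L)
        k<a : x ∸ (i + a) < a
        k<a = +-cancelˡ-< (i + a) _ a (subst (_< i + a + a) (sym (m+[n∸m]≡n i+a≤x)) x<i+a+a)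

    longer-square-period : ∀ {i j a b} → i ≤ 1 → j ≤ 1 → a < b → b < L → L ≤ a + a →
                           SquareAt G i a → SquareAt G j b → ∃[ h ] 0 < h × h ≤ L ∸ b × (∀ x → G (x + h) ≡ G x)
    longer-square-period {i} {j} {a} {b} i≤1 j≤1 a<b b<L L≤a+a sq-a sq-b =
      h , >-nonZero⁻¹ h , h≤q , periodic-of-window gcd[g,L] bound (ConstMod⇒Period
        (ConstMod-overlapping-windows gcd[p,q] i+a≤j+b overlap-bound
          (Period-of-square a+p≡L sq-a) (Period-of-square b+q≡L sq-b)))
      where
        p = L ∸ a
        q = L ∸ b
        a<L = <-trans a<b b<L
        a+p≡L = m+[n∸m]≡n (<⇒≤ a<L)
        b+q≡L = m+[n∸m]≡n (<⇒≤ b<L)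
        q<p : q < p
        q<p = ∸-monoʳ-< a<b (<⇒≤ b<L)
        g = gcd p q
        h = gcd g L
        instance
          p-nonZero : NonZero p
          p-nonZero = >-nonZero (m<n⇒0<n∸m a<L)
          q-nonZero : NonZero q
          q-nonZero = >-nonZero (m<n⇒0<n∸m b<L)
          g-nonZero : NonZero g
          g-nonZero = gcd-nonZero p q
          h-nonZero : NonZero h
          h-nonZero = gcd-nonZero g L
        gcd[p,q] = gcd-GCD p q
        gcd[g,L] = gcd-GCD g L
        h≤q : h ≤ q
        h≤q = ∣⇒≤ (∣-trans (GCD.gcd∣m gcd[g,L]) (GCD.gcd∣n gcd[p,q]))
        i+a≤j+b : i + a ≤ j + b
        i+a≤j+b = ≤-trans (+-monoˡ-≤ a i≤1) (≤-trans a<b (m≤n+m b j))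
        a+[p∸q]≡b : a + (p ∸ q) ≡ b
        a+[p∸q]≡b = +-cancelʳ-≡ q _ _ (begin
          a + (p ∸ q) + q    ≡⟨ +-assoc a (p ∸ q) q ⟩
          a + (p ∸ q + q)    ≡⟨ cong (a +_) (m∸n+n≡m (<⇒≤ q<p)) ⟩
          a + p              ≡⟨ a+p≡L ⟩
          L                  ≡⟨ b+q≡L ⟨
          b + q              ∎)
          where open ≡-Reasoning
        overlap-bound : j + b + p + q ≤ suc (i + a + L)
        overlap-bound = begin
          j + b + p + q      ≡⟨ cong (_+ q) (+-rightComm j b p) ⟩
          j + p + b + q      ≡⟨ +-assoc (j + p) b q ⟩
          j + p + (b + q)    ≡⟨ cong (j + p +_) b+q≡L ⟩
          j + p + L          ≤⟨ +-monoˡ-≤ L (+-mono-≤ j≤1 (m≤n+o⇒m∸n≤o L a L≤a+a)) ⟩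
          suc a + L          ≤⟨ +-monoˡ-≤ L (s≤s (m≤n+m a i)) ⟩
          suc (i + a + L)    ∎
          where open ≤-Reasoning
        bound : i + a + g + L ≤ suc (j + b + L)
        bound = +-monoˡ-≤ L (begin
          i + a + g          ≤⟨ +-monoʳ-≤ (i + a) (GCD⇒≤∸ q<p gcd[p,q]) ⟩
          i + a + (p ∸ q)    ≡⟨ +-assoc i a (p ∸ q) ⟩
          i + (a + (p ∸ q))  ≡⟨ cong (i +_) a+[p∸q]≡b ⟩
          i + b              ≤⟨ +-monoˡ-≤ b i≤1 ⟩
          suc b              ≤⟨ s≤s (m≤n+m b j) ⟩
          suc (j + b)        ∎)
          where open ≤-Reasoning

squares-at-0-and-1⇒periodic : ∀ {B : Set} {f : ℕ → B} {L} → 0 < L → SquareAt f 0 L → SquareAt f 1 L →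
                              ∀ x → x ≤ L → f x ≡ f (x + L)
squares-at-0-and-1⇒periodic {f = f} {L} 0<L sq₀ _ zero _ = trans (sq₀ 0 0<L) (cong f (+-identityʳ L))
squares-at-0-and-1⇒periodic {f = f} {L} _ _ sq₁ (suc x) x<L =
  trans (sq₁ x x<L) (cong (λ z → f (suc z)) (+-comm L x))

module PeriodicExtension {B : Set} (f : ℕ → B) (L : ℕ) .{{_ : NonZero L}}
                         (f-periodic : ∀ x → x ≤ L → f x ≡ f (x + L)) where

  G : ℕ → B
  G x = f (x % L)

  G-periodic : ∀ x → G (x + L) ≡ G x
  G-periodic x = cong f ([m+n]%n≡m%n x L)

  open Periodicity G
  open Periodic L G-periodic

  f≡G-upto-L : ∀ x → x ≤ L → f x ≡ G x
  f≡G-upto-L x x≤L with x <? L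
  ... | yes x<L = cong f (sym (m<n⇒m%n≡m x<L))
  ... | no x≮L with ≤-antisym x≤L (≮⇒≥ x≮L)
  ...   | refl = trans (sym (f-periodic 0 z≤n)) (cong f (sym (n%n≡0 L)))

  f≡G : ∀ x → x ≤ L + L → f x ≡ G x
  f≡G x x≤L+L with x <? L
  ... | yes x<L = f≡G-upto-L x (<⇒≤ x<L)
  ... | no x≮L = begin
    f x        ≡⟨ cong f (m∸n+n≡m L≤x) ⟨
    f (y + L)  ≡⟨ f-periodic y y≤L ⟨
    f y        ≡⟨ f≡G-upto-L y y≤L ⟩
    G y        ≡⟨ G-periodic y ⟨
    G (y + L)  ≡⟨ cong G (m∸n+n≡m L≤x) ⟩
    G x        ∎
    where
      open ≡-Reasoning
      L≤x = ≮⇒≥ x≮L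
      y = x ∸ L
      y≤L = m≤n+o⇒m∸n≤o x L x≤L+L

  SquareAt-G : ∀ {i a} → i ≤ 1 → a < L → SquareAt f i a → SquareAt G i a
  SquareAt-G {i} {a} i≤1 a<L sq k k<a =
    trans (sym (f≡G (i + k) (≤-trans (+-monoˡ-≤ k (m≤m+n i a)) i+a+k≤L+L)))
          (trans (sq k k<a) (f≡G (i + a + k) i+a+k≤L+L))
    where
      i+a+k≤L+L : i + a + k ≤ L + L
      i+a+k≤L+L = ≤-pred (begin
        suc (i + a + k)  ≤⟨ +-monoʳ-< (i + a) k<a ⟩
        i + a + a        ≡⟨ +-assoc i a a ⟩
        i + (a + a)      ≤⟨ +-mono-≤ i≤1 (+-mono-≤ (<⇒≤ a<L) (<⇒≤ a<L)) ⟩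
        suc (L + L)      ∎)
        where open ≤-Reasoning

  reappears-of-period : ∀ {h i n} → (∀ x → G (x + h) ≡ G x) → i + h + n ≤ suc (L + L) → Reappears f i n (i + h)
  reappears-of-period {h} {i} {n} per bound k k<n = begin
    f (i + h + k)  ≡⟨ f≡G (i + h + k) i+h+k≤L+L ⟩
    G (i + h + k)  ≡⟨ cong G (+-rightComm i h k) ⟩
    G (i + k + h)  ≡⟨ per (i + k) ⟩
    G (i + k)      ≡⟨ f≡G (i + k) (≤-trans (+-monoˡ-≤ k (m≤m+n i h)) i+h+k≤L+L) ⟨
    f (i + k)      ∎
    where
      open ≡-Reasoning
      i+h+k≤L+L : i + h + k ≤ L + L
      i+h+k≤L+L = ≤-pred (<-≤-trans (+-monoʳ-< (i + h) k<n) bound)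

  last-square-long : ∀ {i a} → i ≤ 1 → (∀ j → i < j → ¬ Reappears f i (a + a) j) → L ≤ a + a
  last-square-long {i} {a} i≤1 last with L ≤? a + a
  ... | yes L≤a+a = L≤a+a
  ... | no L≰a+a = ⊥-elim (last (i + L) (m<m+n i (>-nonZero⁻¹ L)) (reappears-of-period G-periodic bound))
    where
      bound : i + L + (a + a) ≤ suc (L + L)
      bound = +-mono-≤ (+-monoˡ-≤ L i≤1) (<⇒≤ (≰⇒> L≰a+a))

  longer-square-reappears : ∀ {i j a b} → i ≤ 1 → j ≤ 1 → a < b → b < L → L ≤ a + a →
                            SquareAt f i a → SquareAt f j b → ∃[ h ] 0 < h × Reappears f j (b + b) (j + h)
  longer-square-reappears {i} {j} {a} {b} i≤1 j≤1 a<b b<L L≤a+a sq-a sq-b =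
    let h , 0<h , h≤L∸b , per = longer-square-period i≤1 j≤1 a<b b<L L≤a+a
                                  (SquareAt-G i≤1 (<-trans a<b b<L) sq-a) (SquareAt-G j≤1 b<L sq-b)
    in h , 0<h , reappears-of-period per (bound h≤L∸b)
    where
      bound : ∀ {h} → h ≤ L ∸ b → j + h + (b + b) ≤ suc (L + L)
      bound {h} h≤L∸b = begin
        j + h + (b + b)          ≤⟨ +-monoˡ-≤ (b + b) (+-mono-≤ j≤1 h≤L∸b) ⟩
        suc (L ∸ b + (b + b))    ≡⟨ cong suc (+-assoc (L ∸ b) b b) ⟨
        suc (L ∸ b + b + b)      ≡⟨ cong (λ z → suc (z + b)) (m∸n+n≡m (<⇒≤ b<L)) ⟩
        suc (L + b)              ≤⟨ s≤s (+-monoʳ-≤ L (<⇒≤ b<L)) ⟩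
        suc (L + L)              ∎
        where open ≤-Reasoning

  equal-roots : ∀ {a b} → a < L → b < L → SquareAt f 0 a → SquareAt f 1 b →
                (∀ j → 0 < j → ¬ Reappears f 0 (a + a) j) → (∀ j → 1 < j → ¬ Reappears f 1 (b + b) j) → a ≡ b
  equal-roots {a} {b} a<L b<L sq-a sq-b last-a last-b with <-cmp a b
  ... | tri≈ _ a≡b _ = a≡b
  ... | tri< a<b _ _ =
    let h , 0<h , again = longer-square-reappears z≤n ≤-refl a<b b<L (last-square-long {a = a} z≤n last-a) sq-a sq-b
    in ⊥-elim (last-b (1 + h) (s≤s 0<h) again)
  ... | tri> _ _ b<a =
    let h , 0<h , again = longer-square-reappears ≤-refl z≤n b<a a<L (last-square-long {a = b} ≤-refl last-b) sq-b sq-a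
    in ⊥-elim (last-a h 0<h again)

module _ {A : Set} where

  _!_ : List A → ℕ → Maybe A
  [] ! _ = nothing
  (x ∷ xs) ! zero = just x
  (x ∷ xs) ! suc n = xs ! n

  drop-! : ∀ i (w : List A) k → drop i w ! k ≡ w ! (i + k)
  drop-! zero w k = refl
  drop-! (suc i) [] k = refl
  drop-! (suc i) (x ∷ w) k = drop-! i w k

  Prefix⇒! : ∀ {v ys : List A} → Prefix _≡_ v ys → ∀ k → k < length v → ys ! k ≡ v ! k
  Prefix⇒! (x≡y ∷ _) zero _ = cong just (sym x≡y)
  Prefix⇒! (_ ∷ v≤ys) (suc k) (s≤s k<n) = Prefix⇒! v≤ys k k<n

  !⇒Prefix : ∀ (v ys : List A) → (∀ k → k < length v → ys ! k ≡ v ! k) → Prefix _≡_ v ys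
  !⇒Prefix [] ys _ = []
  !⇒Prefix (x ∷ v) [] agree with agree 0 (s≤s z≤n)
  ... | ()
  !⇒Prefix (x ∷ v) (y ∷ ys) agree =
    sym (just-injective (agree 0 (s≤s z≤n))) ∷ !⇒Prefix v ys (λ k k<n → agree (suc k) (s≤s k<n))

  ++-!ˡ : ∀ (u v : List A) k → k < length u → (u ++ v) ! k ≡ u ! k
  ++-!ˡ (x ∷ u) v zero _ = refl
  ++-!ˡ (x ∷ u) v (suc k) (s≤s k<n) = ++-!ˡ u v k k<n

  ++-!ʳ : ∀ (u v : List A) k → (u ++ v) ! (length u + k) ≡ v ! k
  ++-!ʳ [] v k = refl
  ++-!ʳ (x ∷ u) v k = ++-!ʳ u v k

  OccursAt⇒! : ∀ w i {u} → OccursAt w i u → ∀ k → k < length u + length u → w ! (i + k) ≡ (u ++ u) ! k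
  OccursAt⇒! w i {u} (_ , uu≤w) k k<2n =
    trans (sym (drop-! i w k)) (Prefix⇒! uu≤w k (subst (k <_) (sym (length-++ u)) k<2n))

  OccursAt⇒SquareAt : ∀ w i {u} → OccursAt w i u → SquareAt (w !_) i (length u)
  OccursAt⇒SquareAt w i {u} occ k k<n = begin
    w ! (i + k)               ≡⟨ OccursAt⇒! w i occ k (<-≤-trans k<n (m≤m+n n n)) ⟩
    (u ++ u) ! k              ≡⟨ ++-!ˡ u u k k<n ⟩
    u ! k                     ≡⟨ ++-!ʳ u u k ⟨
    (u ++ u) ! (n + k)        ≡⟨ OccursAt⇒! w i occ (n + k) (+-monoʳ-< n k<n) ⟨
    w ! (i + (n + k))         ≡⟨ cong (w !_) (+-assoc i n k) ⟨
    w ! (i + n + k)           ∎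
    where
      open ≡-Reasoning
      n = length u

  Reappears⇒OccursAt : ∀ w i j {u} → OccursAt w i u → Reappears (w !_) i (length u + length u) j → OccursAt w j u
  Reappears⇒OccursAt w i j {u} occ@(u≢[] , _) again = u≢[] , !⇒Prefix (u ++ u) (drop j w) agree
    where
      agree : ∀ k → k < length (u ++ u) → drop j w ! k ≡ (u ++ u) ! k
      agree k k<2n = let k<n+n = subst (k <_) (length-++ u) k<2n in
        trans (drop-! j w k) (trans (again k k<n+n) (OccursAt⇒! w i occ k k<n+n))

lemma6 : {A : Set} (w sq₁ SQ₁ sq₂ SQ₂ : List A) →
    TwoLastAt w 0 sq₁ SQ₁ → TwoLastAt w 1 sq₂ SQ₂ →
    length SQ₁ ≡ length SQ₂ → length sq₁ ≡ length sq₂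
lemma6 w sq₁ SQ₁ sq₂ SQ₂ ((occ₁ , last₁) , (OCC₁ , _) , a<L , _) ((occ₂ , last₂) , (OCC₂ , _) , b<L₂ , _) L₁≡L₂ =
  equal-roots a<L (subst (length sq₂ <_) (sym L₁≡L₂) b<L₂) (OccursAt⇒SquareAt w 0 occ₁) (OccursAt⇒SquareAt w 1 occ₂)
    (λ j 0<j again → last₁ j 0<j (Reappears⇒OccursAt w 0 j occ₁ again))
    (λ j 1<j again → last₂ j 1<j (Reappears⇒OccursAt w 1 j occ₂ again))
  where
    L = length SQ₁
    instance
      L-nonZero : NonZero L
      L-nonZero = >-nonZero (≤-<-trans z≤n a<L)
    f-periodic : ∀ x → x ≤ L → w ! x ≡ w ! (x + L)
    f-periodic = squares-at-0-and-1⇒periodic (>-nonZero⁻¹ L) (OccursAt⇒SquareAt w 0 OCC₁)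
                   (subst (SquareAt (w !_) 1) (sym L₁≡L₂) (OccursAt⇒SquareAt w 1 OCC₂))
    open PeriodicExtension (w !_) L f-periodic
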